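{- For any integer $r$, there exists an integer $n$ such that $b_2(W_n)-t_2(W_n)\ge r$.
   Context: The wheel graph $W_n$ is obtained from the cycle $C_n$ by adding one central vertex adjacent to all $n$ vertices of the cycle. The 2-burning process: given a graph $G$ and a sequence $s=(s_1,\dots,s_m)$ of vertices of $G$ (sources), at round $0$ all vertices are uncolored; at each round $j\ge1$, (i) if $j\le m$ and $s_j$ is uncolored, $s_j$ is colored blue, and (ii) every uncolored vertex having at least two neighbors that were blue at the end of round $j-1$ is colored blue. $s$ is a 2-burning sequence if eventually all vertices are blue; $\mathrm{len}(s)=m$ and $\mathrm{rd}(s)$ is the first round at the end of which all vertices are blue. $b_2(G)$ is the minimum of $\mathrm{rd}(s)$ over all 2-burning sequences; a 2-burning sequence achieving it is optimal; $t_2(G)$ is the minimum length of an optimal 2-burning sequence. -}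

module Defs where

open import Data.Nat using (ℕ; zero; suc; _+_; _≤_; _<_; _≟_)
open import Data.Bool using (Bool; true; false; _∨_; _∧_; if_then_else_; T)
open import Data.Fin using (Fin; zero; suc; toℕ)
open import Data.Fin.Properties using () renaming (_≟_ to _≟ᶠ_)
open import Data.List using (List; []; _∷_; length; map; allFin)
open import Data.Nat.ListAction using (sum)
open import Data.Product using (Σ; _×_)
open import Relation.Nullary using (¬_)
open import Relation.Nullary.Decidable using (⌊_⌋)
open import Relation.Binary.PropositionalEquality using (_≡_)

record Graph : Set where
  field
    V   : ℕ
    adj : Fin V → Fin V → Bool
open Graph public

cycAdj : (n : ℕ) → Fin n → Fin n → Bool
cycAdj n i j =
  ⌊ toℕ j ≟ suc (toℕ i) ⌋ ∨ ⌊ toℕ i ≟ suc (toℕ j) ⌋ ∨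
  (⌊ toℕ i ≟ 0 ⌋ ∧ ⌊ suc (toℕ j) ≟ n ⌋) ∨ (⌊ toℕ j ≟ 0 ⌋ ∧ ⌊ suc (toℕ i) ≟ n ⌋)

-- Wheel W_n: vertex zero is the centre, vertex suc i is cycle vertex i.
wheelAdj : (n : ℕ) → Fin (suc n) → Fin (suc n) → Bool
wheelAdj n zero    zero    = false
wheelAdj n zero    (suc j) = true
wheelAdj n (suc i) zero    = true
wheelAdj n (suc i) (suc j) = cycAdj n i j

Wheel : ℕ → Graph
Wheel n = record { V = suc n ; adj = wheelAdj n }

-- Colourings: true = blue.
Colouring : Graph → Set
Colouring G = Fin (V G) → Bool

blueNbrs : (G : Graph) → Colouring G → Fin (V G) → ℕ
blueNbrs G c v = sum (map (λ u → if adj G v u ∧ c u then 1 else 0) (allFin (V G)))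

-- the source s_j (1-indexed) equals v ?   (false if j = 0 or j > length s)
isSource : (G : Graph) → List (Fin (V G)) → ℕ → Fin (V G) → Bool
isSource G []       j             v = false
isSource G (x ∷ s)  zero          v = false
isSource G (x ∷ s)  (suc zero)    v = ⌊ x ≟ᶠ v ⌋
isSource G (x ∷ s)  (suc (suc j)) v = isSource G s (suc j) v

-- colouring at the end of round j of the 2-burning process with source sequence s
state : (G : Graph) → List (Fin (V G)) → ℕ → Colouring G
state G s zero    v = false
state G s (suc j) v =
  state G s j v ∨ isSource G s (suc j) v ∨ ⌊ 2 Data.Nat.≤? blueNbrs G (state G s j) v ⌋

AllBlue : (G : Graph) → Colouring G → Set
AllBlue G c = (v : Fin (V G)) → T (c v)

IsRd : (G : Graph) → List (Fin (V G)) → ℕ → Set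
IsRd G s k = AllBlue G (state G s k) × ((j : ℕ) → j < k → ¬ AllBlue G (state G s j))

IsB2 : Graph → ℕ → Set
IsB2 G b = Σ (List (Fin (V G))) (λ s → IsRd G s b)
         × ((s : List (Fin (V G))) (k : ℕ) → IsRd G s k → b ≤ k)

IsT2 : Graph → ℕ → Set
IsT2 G t = Σ ℕ λ b → IsB2 G b
         × Σ (List (Fin (V G))) (λ s → IsRd G s b × length s ≡ t)
         × ((s : List (Fin (V G))) → IsRd G s b → t ≤ length s)

{-# OPTIONS --safe #-}
module Submission where

-- A rim vertex of the wheel has the hub as its only neighbour off the rim, so it can turn blue
-- only next to a blue rim vertex: by round k the source placed in round j has coloured at most
-- 2(k − j) + 1 rim vertices. With L sources and k rounds the rim size n is thus at most
-- Σ_{j ≤ min(k, L)} (2(k − j) + 1), which is at most k², and L² + 2L(k − L) when L ≤ k.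
-- Conversely, once two sources have made the hub blue, every blue rim vertex colours both rim
-- neighbours in the next round. With d = 3 + ∣r∣ and y₀ = d², a rim made of arcs of radii
-- d, d + 1, …, d + y₀ (sources in rounds y₀ + 3, …, 3) and two arcs of radius y₀ + d (the
-- first two sources) burns in b = y₀ + d + 3 rounds with t = y₀ + 3 sources, and n is chosen
-- just above both bounds for k = b − 1 and for L = t − 1, k = b. Hence b₂ = b, t₂ = t and
-- b₂ − t₂ = d.

module WheelBurning where

  open import Defs
  open import Data.Bool using (Bool; true; false; _∧_; if_then_else_; T)
  open import Data.Bool.Properties using (T-∨; T-∧; T-≡)
  open import Data.Empty using (⊥-elim)
  open import Data.Fin using (Fin; zero; suc; toℕ; fromℕ<)
  open import Data.Fin.Properties using (toℕ-injective; toℕ-fromℕ<; fromℕ<-toℕ; toℕ<n; injective⇒≤)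
  import Data.Fin.Properties as Fin
  open import Data.List using (List; []; _∷_; _++_; length; map; tabulate; allFin; lookup)
  open import Data.List.Membership.Propositional using (_∈_)
  open import Data.List.Membership.Propositional.Properties
    using (∈-map⁺; ∈-map⁻; ∈-allFin; ∈-++⁺ˡ; ∈-++⁺ʳ; ∈-++⁻)
  open import Data.List.Properties using (map-tabulate; length-map; length-++; length-tabulate)
  open import Data.List.Relation.Unary.Any using (index)
  open import Data.List.Relation.Unary.Any.Properties using (lookup-index)
  open import Data.Nat using (ℕ; zero; suc; _+_; _*_; _∸_; _%_; _≤_; _<_; _≥_; _≟_; _<?_; z≤n; s≤s; s≤s⁻¹)
  open import Data.Nat using (_≤′_; ≤′-reflexive; ≤′-step)
  open import Data.Nat.DivMod using (_mod_; %-distribˡ-+; m%n%n≡m%n; n%n≡0; m<n⇒m%n≡m; [m+kn]%n≡m%n)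
  open import Data.Nat.ListAction using (sum)
  open import Data.Nat.Properties
  open import Data.Nat.Tactic.RingSolver using (solve-∀)
  open import Data.Product using (∃; ∃₂; _×_; _,_; proj₁)
  open import Data.Sum using (_⊎_; inj₁; inj₂; map₂)
  import Data.Sum as Sum
  open import Function using (id; _∘_)
  open import Function.Bundles using (Equivalence; _⇔_; mk⇔)
  open import Relation.Binary.Definitions using (tri<; tri≈; tri>)
  open import Relation.Binary.PropositionalEquality
    using (_≡_; _≢_; refl; sym; trans; cong; subst; subst₂; module ≡-Reasoning)
  open import Relation.Nullary using (¬_; Dec; yes; no)
  open import Relation.Nullary.Decidable using (⌊_⌋; toWitness; fromWitness)

  open Equivalence using (to; from)

  countTrue : ∀ {k} → (Fin k → Bool) → ℕ
  countTrue f = sum (tabulate (λ i → if f i then 1 else 0))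

  countTrue-≥1 : ∀ {k} (f : Fin k → Bool) (i : Fin k) → T (f i) → 1 ≤ countTrue f
  countTrue-≥1 f zero    fi with f zero | fi
  ... | true | _ = s≤s z≤n
  countTrue-≥1 f (suc i) fi = ≤-trans (countTrue-≥1 (f ∘ suc) i fi) (m≤n+m _ _)

  countTrue-≥2 : ∀ {k} (f : Fin k → Bool) {i j : Fin k} → i ≢ j → T (f i) → T (f j) →
                 2 ≤ countTrue f
  countTrue-≥2 f {zero}  {zero}  i≢j _  _  = ⊥-elim (i≢j refl)
  countTrue-≥2 f {zero}  {suc j} _   fi fj with f zero | fi
  ... | true | _ = s≤s (countTrue-≥1 (f ∘ suc) j fj)
  countTrue-≥2 f {suc i} {zero}  i≢j fi fj = countTrue-≥2 f (i≢j ∘ sym) fj fi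
  countTrue-≥2 f {suc i} {suc j} i≢j fi fj =
    ≤-trans (countTrue-≥2 (f ∘ suc) (i≢j ∘ cong suc) fi fj) (m≤n+m _ _)

  countTrue-≥1⇒ : ∀ {k} (f : Fin k → Bool) → 1 ≤ countTrue f → ∃ λ i → T (f i)
  countTrue-≥1⇒ {suc k} f h with f zero in f0
  ... | true  = zero , T-≡ .from f0
  ... | false = let i , fi = countTrue-≥1⇒ (f ∘ suc) h in suc i , fi

  countTrue-≥2⇒ : ∀ {k} (f : Fin k → Bool) → 2 ≤ countTrue f →
                  ∃₂ λ i j → i ≢ j × T (f i) × T (f j)
  countTrue-≥2⇒ {suc k} f h with f zero in f0
  ... | true  = let j , fj = countTrue-≥1⇒ (f ∘ suc) (s≤s⁻¹ h) in
                zero , suc j , (λ ()) , T-≡ .from f0 , fj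
  ... | false = let i , j , i≢j , fi , fj = countTrue-≥2⇒ (f ∘ suc) h in
                suc i , suc j , i≢j ∘ Fin.suc-injective , fi , fj

  module Burning (G : Graph) where

    Sources : Set
    Sources = List (Fin (V G))

    -- A record rather than T (state G s k v) itself, so that s, k and v can be inferred.
    record Blue (s : Sources) (k : ℕ) (v : Fin (V G)) : Set where
      constructor blue
      field isBlue : T (state G s k v)
    open Blue public

    blueNbrs≡countTrue : ∀ c v → blueNbrs G c v ≡ countTrue (λ u → adj G v u ∧ c u)
    blueNbrs≡countTrue c v = cong sum (map-tabulate id (λ u → if adj G v u ∧ c u then 1 else 0))

    blueNbrs-≥2 : ∀ c v {u u'} → u ≢ u' →
                  T (adj G v u) → T (c u) → T (adj G v u') → T (c u') → 2 ≤ blueNbrs G c v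
    blueNbrs-≥2 c v u≢u' vu cu vu' cu' rewrite blueNbrs≡countTrue c v =
      countTrue-≥2 _ u≢u' (T-∧ .from (vu , cu)) (T-∧ .from (vu' , cu'))

    blueNbrs-≥2⇒ : ∀ c v → 2 ≤ blueNbrs G c v →
                   ∃₂ λ u u' → u ≢ u' × (T (adj G v u) × T (c u)) × (T (adj G v u') × T (c u'))
    blueNbrs-≥2⇒ c v h rewrite blueNbrs≡countTrue c v =
      let u , u' , u≢u' , bu , bu' = countTrue-≥2⇒ _ h
      in  u , u' , u≢u' , T-∧ .to bu , T-∧ .to bu'

    blue-round : ∀ {s k v} → Blue s (suc k) v ⇔
                 (Blue s k v ⊎ T (isSource G s (suc k) v) ⊎ 2 ≤ blueNbrs G (state G s k) v)
    blue-round {s} {k} {v} = mk⇔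
      (λ (blue h) → Sum.map blue (map₂ toWitness ∘ T-∨ .to) (T-∨ .to h))
      (λ h → blue (T-∨ {state G s k v} .from
                     (Sum.map isBlue (T-∨ {isSource G s (suc k) v} .from ∘ map₂ fromWitness) h)))

    blue-suc : ∀ {s k v} → Blue s k v → Blue s (suc k) v
    blue-suc = blue-round .from ∘ inj₁

    blue-mono : ∀ {s k k' v} → k ≤ k' → Blue s k v → Blue s k' v
    blue-mono = go ∘ ≤⇒≤′
      where
      go : ∀ {s k k' v} → k ≤′ k' → Blue s k v → Blue s k' v
      go (≤′-reflexive refl) b = b
      go (≤′-step k≤k')      b = blue-suc (go k≤k' b)

    source⇒blue : ∀ {s k v} → T (isSource G s (suc k) v) → Blue s (suc k) v
    source⇒blue = blue-round .from ∘ inj₂ ∘ inj₁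

    blueNbrs⇒blue : ∀ {s k v} → 2 ≤ blueNbrs G (state G s k) v → Blue s (suc k) v
    blueNbrs⇒blue = blue-round .from ∘ inj₂ ∘ inj₂

    isSource-head : ∀ x s → T (isSource G (x ∷ s) 1 x)
    isSource-head x s = fromWitness refl

    Burnt : Sources → ℕ → Set
    Burnt s k = ∀ v → Blue s k v

    module _ (b : ℕ) (notBefore : ∀ s k → k < b → ¬ Burnt s k) where

      isRd-intro : ∀ {s} → Burnt s b → IsRd G s b
      isRd-intro {s} burnt = isBlue ∘ burnt , λ k k<b all → notBefore s k k<b (blue ∘ all)

      isB2-intro : ∀ s → Burnt s b → IsB2 G b
      isB2-intro s burnt = (s , isRd-intro burnt) ,
        λ s' k rd → ≮⇒≥ (λ k<b → notBefore s' k k<b (blue ∘ proj₁ rd))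

      isT2-intro : ∀ {t} s → Burnt s b → length s ≡ t →
                   (∀ s' → length s' < t → ¬ Burnt s' b) → IsT2 G t
      isT2-intro s burnt len≡t tooShort = b , isB2-intro s burnt , (s , isRd-intro burnt , len≡t) ,
        λ s' rd → ≮⇒≥ (λ short → tooShort s' short (blue ∘ proj₁ rd))

  cycAdj-suc : ∀ {n} (v u : Fin n) → toℕ u ≡ suc (toℕ v) → T (cycAdj n v u)
  cycAdj-suc v u u≡1+v with toℕ u ≟ suc (toℕ v)
  ... | yes _    = _
  ... | no u≢1+v = ⊥-elim (u≢1+v u≡1+v)

  cycAdj-pred : ∀ {n} (v u : Fin n) → toℕ v ≡ suc (toℕ u) → T (cycAdj n v u)
  cycAdj-pred v u v≡1+u with toℕ u ≟ suc (toℕ v) | toℕ v ≟ suc (toℕ u)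
  ... | yes _ | _        = _
  ... | no _  | yes _    = _
  ... | no _  | no v≢1+u = ⊥-elim (v≢1+u v≡1+u)

  module OnWheel (n : ℕ) where
    open Burning (Wheel n)

    wheel-rim-nbr : ∀ c v → 2 ≤ blueNbrs (Wheel n) c (suc v) →
                    ∃ λ u → T (cycAdj n v u) × T (c (suc u))
    wheel-rim-nbr c v h with blueNbrs-≥2⇒ c (suc v) h
    ... | suc u , _     , _   , bu , _   = u , bu
    ... | zero  , suc u , _   , _  , bu  = u , bu
    ... | zero  , zero  , 0≢0 , _  , _   = ⊥-elim (0≢0 refl)

    wheel-hub : ∀ c {u u'} → u ≢ u' → T (c (suc u)) → T (c (suc u')) → 2 ≤ blueNbrs (Wheel n) c zero
    wheel-hub c u≢u' cu cu' = blueNbrs-≥2 c zero (u≢u' ∘ Fin.suc-injective) _ cu _ cu'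

    wheel-rim : ∀ c v u → T (c zero) → T (cycAdj n v u) → T (c (suc u)) →
                2 ≤ blueNbrs (Wheel n) c (suc v)
    wheel-rim c v u c0 vu cu = blueNbrs-≥2 c (suc v) (λ ()) _ c0 vu cu

    hub-rim-spread : ∀ {s k v u} → Blue s k zero → Blue s k (suc u) → T (cycAdj n v u) →
                     Blue s (suc k) (suc v)
    hub-rim-spread {s} {k} {v} {u} (blue h0) (blue hu) vu =
      blueNbrs⇒blue (wheel-rim (state (Wheel n) s k) v u h0 vu hu)

    module _ {s : Sources} {k : ℕ} (c : Fin n) (hub : Blue s k zero) (centre : Blue s k (suc c)) where

      private
        at-centre : ∀ {q} (q<n : q < n) → q ≡ toℕ c → Blue s k (suc (fromℕ< q<n))
        at-centre q<n q≡c =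
          subst (λ w → Blue s k (suc w)) (sym (toℕ-injective (trans (toℕ-fromℕ< q<n) q≡c))) centre

      rim-interval-blue : ∀ δ {q} (q<n : q < n) → q ≤ toℕ c + δ → toℕ c ≤ q + δ →
                          Blue s (δ + k) (suc (fromℕ< q<n))
      rim-interval-blue zero {q} q<n q≤c+0 c≤q+0 = at-centre q<n (≤-antisym q≤c c≤q)
        where
        q≤c : q ≤ toℕ c
        q≤c = subst (q ≤_) (+-identityʳ (toℕ c)) q≤c+0
        c≤q : toℕ c ≤ q
        c≤q = subst (toℕ c ≤_) (+-identityʳ q) c≤q+0
      rim-interval-blue (suc δ) {q} q<n q≤c+δ c≤q+δ with <-cmp q (toℕ c)
      ... | tri≈ _ q≡c _ = blue-mono (m≤n+m k (suc δ)) (at-centre q<n q≡c)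
      ... | tri< q<c _ _ =
        hub-rim-spread (blue-mono (m≤n+m k δ) hub)
          (rim-interval-blue δ q⁺<n (≤-trans q<c (m≤m+n (toℕ c) δ)) (subst (toℕ c ≤_) (+-suc q δ) c≤q+δ))
          (cycAdj-suc _ _ (trans (toℕ-fromℕ< q⁺<n) (cong suc (sym (toℕ-fromℕ< q<n)))))
        where
        q⁺<n : suc q < n
        q⁺<n = ≤-<-trans q<c (toℕ<n c)
      rim-interval-blue (suc δ) {suc q} q<n q≤c+δ c≤q+δ | tri> _ _ c<q =
        hub-rim-spread (blue-mono (m≤n+m k δ) hub)
          (rim-interval-blue δ q⁻<n q≤c+δ′ (≤-trans (s≤s⁻¹ c<q) (m≤m+n q δ)))
          (cycAdj-pred _ _ (trans (toℕ-fromℕ< q<n) (cong suc (sym (toℕ-fromℕ< q⁻<n)))))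
        where
        q⁻<n : q < n
        q⁻<n = <-trans (n<1+n q) q<n
        q≤c+δ′ : q ≤ toℕ c + δ
        q≤c+δ′ = s≤s⁻¹ (subst (suc q ≤_) (+-suc (toℕ c) δ) q≤c+δ)

  module Rim (p : ℕ) where

    n : ℕ
    n = suc p

    infix 4 _≡ₘ_
    _≡ₘ_ : ℕ → ℕ → Set
    a ≡ₘ b = a % n ≡ b % n

    ≡ₘ-+ʳ : ∀ a b x → a ≡ₘ b → a + x ≡ₘ b + x
    ≡ₘ-+ʳ a b x a≡b = begin
      (a + x) % n           ≡⟨ %-distribˡ-+ a x n ⟩
      (a % n + x % n) % n   ≡⟨ cong (λ z → (z + x % n) % n) a≡b ⟩
      (b % n + x % n) % n   ≡⟨ %-distribˡ-+ b x n ⟨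
      (b + x) % n           ∎
      where open ≡-Reasoning

    ≡ₘ-+ˡ : ∀ x a b → a ≡ₘ b → x + a ≡ₘ x + b
    ≡ₘ-+ˡ x a b a≡b = begin
      (x + a) % n           ≡⟨ %-distribˡ-+ x a n ⟩
      (x % n + a % n) % n   ≡⟨ cong (λ z → (x % n + z) % n) a≡b ⟩
      (x % n + b % n) % n   ≡⟨ %-distribˡ-+ x b n ⟨
      (x + b) % n           ∎
      where open ≡-Reasoning

    ≡ₘ-+suc : ∀ a b {r e} → a + r ≡ₘ b + e → a + suc r ≡ₘ b + suc e
    ≡ₘ-+suc a b {r} {e} h =
      subst₂ _≡ₘ_ (sym (+-suc a r)) (sym (+-suc b e)) (≡ₘ-+ˡ 1 (a + r) (b + e) h)

    +-p*r+r : ∀ x r → x + p * r + r ≡ₘ x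
    +-p*r+r x r = trans (cong (_% n) (eq p x r)) ([m+kn]%n≡m%n x r n)
      where
      eq : ∀ p x r → x + p * r + r ≡ x + r * suc p
      eq = solve-∀

    +-r+p*r : ∀ x r → x + r + p * r ≡ₘ x
    +-r+p*r x r = trans (cong (_% n) (eq p x r)) ([m+kn]%n≡m%n x r n)
      where
      eq : ∀ p x r → x + r + p * r ≡ x + r * suc p
      eq = solve-∀

    toℕ-% : ∀ (v : Fin n) → toℕ v % n ≡ toℕ v
    toℕ-% v = m<n⇒m%n≡m (toℕ<n v)

    toℕ-mod : ∀ x → toℕ (x mod n) ≡ x % n
    toℕ-mod x = toℕ-fromℕ< _

    wrap⇒≡ₘ : ∀ a b → T (⌊ a ≟ 0 ⌋ ∧ ⌊ suc b ≟ n ⌋) → suc b ≡ₘ a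
    wrap⇒≡ₘ a b h with a ≟ 0 | suc b ≟ n
    ... | yes refl | yes 1+b≡n = trans (cong (_% n) 1+b≡n) (n%n≡0 n)

    cycAdj⇒≡ₘ : ∀ (v u : Fin n) → T (cycAdj n v u) →
                (suc (toℕ v) ≡ₘ toℕ u) ⊎ (suc (toℕ u) ≡ₘ toℕ v)
    cycAdj⇒≡ₘ v u h with toℕ u ≟ suc (toℕ v)
    ... | yes u≡1+v = inj₁ (cong (_% n) (sym u≡1+v))
    ... | no _ with toℕ v ≟ suc (toℕ u)
    ...   | yes v≡1+u = inj₂ (cong (_% n) (sym v≡1+u))
    ...   | no _ with ⌊ toℕ v ≟ 0 ⌋ ∧ ⌊ suc (toℕ u) ≟ n ⌋ in vu-wraps
    ...     | true  = inj₂ (wrap⇒≡ₘ (toℕ v) (toℕ u) (T-≡ .from vu-wraps))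
    ...     | false = inj₁ (wrap⇒≡ₘ (toℕ u) (toℕ v) h)

    -- p * r ≡ - r (mod n), so arc w r is the cyclic interval [w - r, w + r].
    arc : Fin n → ℕ → List (Fin n)
    arc w r = map (λ e → (toℕ w + toℕ e + p * r) mod n) (allFin (suc (r + r)))

    InArc : Fin n → ℕ → Fin n → Set
    InArc w r v = ∃ λ e → e ≤ r + r × toℕ v + r ≡ₘ toℕ w + e

    ∈arc⇒ : ∀ w r {v} → v ∈ arc w r → InArc w r v
    ∈arc⇒ w r {v} v∈ with ∈-map⁻ _ v∈
    ... | e , _ , refl = toℕ e , s≤s⁻¹ (toℕ<n e) , (begin
      (toℕ v + r) % n             ≡⟨ cong (λ z → (z + r) % n) (toℕ-mod (x + p * r)) ⟩
      ((x + p * r) % n + r) % n   ≡⟨ ≡ₘ-+ʳ ((x + p * r) % n) (x + p * r) r (m%n%n≡m%n (x + p * r) n) ⟩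
      (x + p * r + r) % n         ≡⟨ +-p*r+r x r ⟩
      x % n                       ∎)
      where
      open ≡-Reasoning
      x = toℕ w + toℕ e

    ⇒∈arc : ∀ w r {v} → InArc w r v → v ∈ arc w r
    ⇒∈arc w r {v} (e , e≤2r , v+r≡w+e) =
      subst (_∈ arc w r) (sym (toℕ-injective v≡)) (∈-map⁺ _ (∈-allFin e′))
      where
      e′ : Fin (suc (r + r))
      e′ = fromℕ< (s≤s e≤2r)
      open ≡-Reasoning
      v≡ : toℕ v ≡ toℕ ((toℕ w + toℕ e′ + p * r) mod n)
      v≡ = begin
        toℕ v                        ≡⟨ toℕ-% v ⟨
        toℕ v % n                    ≡⟨ +-r+p*r (toℕ v) r ⟨
        (toℕ v + r + p * r) % n      ≡⟨ ≡ₘ-+ʳ (toℕ v + r) (toℕ w + e) (p * r) v+r≡w+e ⟩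
        (toℕ w + e + p * r) % n      ≡⟨ cong (λ z → (toℕ w + z + p * r) % n) (toℕ-fromℕ< (s≤s e≤2r)) ⟨
        (toℕ w + toℕ e′ + p * r) % n ≡⟨ toℕ-mod (toℕ w + toℕ e′ + p * r) ⟨
        toℕ ((toℕ w + toℕ e′ + p * r) mod n) ∎

    arc-centre : ∀ w → w ∈ arc w 0
    arc-centre w = ⇒∈arc w 0 (0 , z≤n , refl)

    arc-mono : ∀ w r {v} → v ∈ arc w r → v ∈ arc w (suc r)
    arc-mono w r {v} v∈ with ∈arc⇒ w r v∈
    ... | e , e≤2r , v+r≡w+e =
      ⇒∈arc w (suc r)
        (suc e , s≤s (≤-trans e≤2r (+-monoʳ-≤ r (n≤1+n r))) , ≡ₘ-+suc (toℕ v) (toℕ w) v+r≡w+e)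

    arc-step : ∀ w r {u v} → u ∈ arc w r → T (cycAdj n v u) → v ∈ arc w (suc r)
    arc-step w r {u} {v} u∈ vu with ∈arc⇒ w r u∈ | cycAdj⇒≡ₘ v u vu
    ... | e , e≤2r , u+r≡w+e | inj₁ 1+v≡u =
      ⇒∈arc w (suc r) (e , ≤-trans e≤2r (+-mono-≤ (n≤1+n r) (n≤1+n r)) , (begin
        (toℕ v + suc r) % n   ≡⟨ cong (_% n) (+-suc (toℕ v) r) ⟩
        (suc (toℕ v) + r) % n ≡⟨ ≡ₘ-+ʳ (suc (toℕ v)) (toℕ u) r 1+v≡u ⟩
        (toℕ u + r) % n       ≡⟨ u+r≡w+e ⟩
        (toℕ w + e) % n       ∎))
      where open ≡-Reasoning
    ... | e , e≤2r , u+r≡w+e | inj₂ 1+u≡v =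
      ⇒∈arc w (suc r) (suc (suc e) , s≤s (≤-trans (s≤s e≤2r) (≤-reflexive (sym (+-suc r r)))) , (begin
        (toℕ v + suc r) % n       ≡⟨ ≡ₘ-+ʳ (suc (toℕ u)) (toℕ v) (suc r) 1+u≡v ⟨
        (suc (toℕ u) + suc r) % n ≡⟨ ≡ₘ-+ˡ 1 _ (toℕ w + suc e) (≡ₘ-+suc (toℕ u) (toℕ w) u+r≡w+e) ⟩
        (suc (toℕ w + suc e)) % n ≡⟨ cong (_% n) (+-suc (toℕ w) (suc e)) ⟨
        (toℕ w + suc (suc e)) % n ∎))
      where open ≡-Reasoning

  complete⇒≤length : ∀ {n} (L : List (Fin n)) → (∀ v → v ∈ L) → n ≤ length L
  complete⇒≤length L complete = injective⇒≤ λ {a} {b} ia≡ib → begin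
    a                              ≡⟨ lookup-index (complete a) ⟩
    lookup L (index (complete a))  ≡⟨ cong (lookup L) ia≡ib ⟩
    lookup L (index (complete b))  ≡⟨ lookup-index (complete b) ⟨
    b                              ∎
    where open ≡-Reasoning

  coverBound : ℕ → ℕ → ℕ
  coverBound zero    _       = 0
  coverBound (suc k) zero    = 0
  coverBound (suc k) (suc L) = suc (k + k) + coverBound k L

  coverBound-monoʳ : ∀ k {L L'} → L ≤ L' → coverBound k L ≤ coverBound k L'
  coverBound-monoʳ zero    _         = z≤n
  coverBound-monoʳ (suc k) z≤n       = z≤n
  coverBound-monoʳ (suc k) (s≤s L≤L') = +-monoʳ-≤ (suc (k + k)) (coverBound-monoʳ k L≤L')

  coverBound≤square : ∀ k L → coverBound k L ≤ k * k
  coverBound≤square zero    _       = z≤n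
  coverBound≤square (suc k) zero    = z≤n
  coverBound≤square (suc k) (suc L) = begin
    suc (k + k) + coverBound k L ≤⟨ +-monoʳ-≤ (suc (k + k)) (coverBound≤square k L) ⟩
    suc (k + k) + k * k          ≡⟨ eq k ⟩
    suc k * suc k                ∎
    where
    open ≤-Reasoning
    eq : ∀ k → suc (k + k) + k * k ≡ suc k * suc k
    eq = solve-∀

  coverBound-+ : ∀ L D → coverBound (L + D) L ≡ L * L + 2 * L * D
  coverBound-+ zero    zero    = refl
  coverBound-+ zero    (suc D) = refl
  coverBound-+ (suc L) D = begin
    suc ((L + D) + (L + D)) + coverBound (L + D) L ≡⟨ cong (suc ((L + D) + (L + D)) +_) (coverBound-+ L D) ⟩
    suc ((L + D) + (L + D)) + (L * L + 2 * L * D)  ≡⟨ eq L D ⟩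
    suc L * suc L + 2 * suc L * D                  ∎
    where
    open ≡-Reasoning
    eq : ∀ L D → suc ((L + D) + (L + D)) + (L * L + 2 * L * D) ≡ suc L * suc L + 2 * suc L * D
    eq = solve-∀

  module LowerBound (p : ℕ) where
    open Rim p
    open Burning (Wheel n)
    open OnWheel n

    ball : Fin (suc n) → ℕ → List (Fin n)
    ball zero    _ = []
    ball (suc w) r = arc w r

    -- The j-th source has been spreading along the rim for at most k - j rounds by round k.
    reach : Sources → ℕ → List (Fin n)
    reach []      _       = []
    reach (x ∷ s) zero    = []
    reach (x ∷ s) (suc k) = ball x k ++ reach s k

    reach-lift : ∀ {u v} → (∀ x r → u ∈ ball x r → v ∈ ball x (suc r)) →
                 ∀ s k → u ∈ reach s k → v ∈ reach s (suc k)
    reach-lift lift (x ∷ s) (suc k) u∈ with ∈-++⁻ (ball x k) u∈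
    ... | inj₁ u∈ball  = ∈-++⁺ˡ (lift x k u∈ball)
    ... | inj₂ u∈reach = ∈-++⁺ʳ (ball x (suc k)) (reach-lift lift s k u∈reach)

    reach-mono : ∀ s k {v} → v ∈ reach s k → v ∈ reach s (suc k)
    reach-mono s k = reach-lift (λ { (suc w) r → arc-mono w r }) s k

    reach-step : ∀ s k {u v} → T (cycAdj n v u) → u ∈ reach s k → v ∈ reach s (suc k)
    reach-step s k vu = reach-lift (λ { (suc w) r u∈ → arc-step w r u∈ vu }) s k

    source∈reach : ∀ s k {v} → T (isSource (Wheel n) s (suc k) (suc v)) → v ∈ reach s (suc k)
    source∈reach (x ∷ s) zero    {v} x≡v with x Fin.≟ suc v
    ... | yes refl = ∈-++⁺ˡ (arc-centre v)
    source∈reach (x ∷ s) (suc k) src = ∈-++⁺ʳ (ball x (suc k)) (source∈reach s k src)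

    blue⇒∈reach : ∀ s k {v} → Blue s k (suc v) → v ∈ reach s k
    blue⇒∈reach s (suc k) b with blue-round .to b
    ... | inj₁ b′          = reach-mono s k (blue⇒∈reach s k b′)
    ... | inj₂ (inj₁ src)  = source∈reach s k src
    ... | inj₂ (inj₂ nbrs) with wheel-rim-nbr (state (Wheel n) s k) _ nbrs
    ...   | u , vu , bu    = reach-step s k vu (blue⇒∈reach s k (blue bu))

    length-reach : ∀ s k → length (reach s k) ≤ coverBound k (length s)
    length-reach []      _       = z≤n
    length-reach (x ∷ s) zero    = z≤n
    length-reach (x ∷ s) (suc k) = begin
      length (ball x k ++ reach s k)          ≡⟨ length-++ (ball x k) ⟩
      length (ball x k) + length (reach s k)  ≤⟨ +-mono-≤ (length-ball x) (length-reach s k) ⟩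
      suc (k + k) + coverBound k (length s)   ∎
      where
      open ≤-Reasoning
      length-ball : ∀ x → length (ball x k) ≤ suc (k + k)
      length-ball zero    = z≤n
      length-ball (suc w) =
        ≤-reflexive (trans (length-map _ (allFin (suc (k + k)))) (length-tabulate {n = suc (k + k)} id))

    burnt⇒≤coverBound : ∀ s k → Burnt s k → n ≤ coverBound k (length s)
    burnt⇒≤coverBound s k burnt = ≤-trans
      (complete⇒≤length (reach s k) (λ v → blue⇒∈reach s k (burnt (suc v))))
      (length-reach s k)

  m<n+1+2r⇒m≤n+r+r : ∀ {m} n r → m < n + suc (r + r) → m ≤ n + r + r
  m<n+1+2r⇒m≤n+r+r n r m< = begin
    _               ≤⟨ s≤s⁻¹ (≤-trans m< (≤-reflexive (+-suc n (r + r)))) ⟩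
    n + (r + r)     ≡⟨ +-assoc n r r ⟨
    n + r + r       ∎
    where open ≤-Reasoning

  module Construction (e : ℕ) where

    d y₀ R m : ℕ
    d  = 3 + e
    y₀ = d * d
    R  = y₀ + d
    m  = 3 + y₀

    -- Opaque because the typechecker would otherwise unfold the burning process for b rounds.
    opaque
      b : ℕ
      b = m + d

      b≡m+d : b ≡ m + d
      b≡m+d = refl

    -- The rim is cut into consecutive arcs: tile y (y ≤ y₀) covers [tileStart y, tileStart (suc y))
    -- around tileCentre y with radius y + d, and its source is placed in round 3 + (y₀ − y); then
    -- come the arcs of radius R around cA and cA', the first two sources, which make the hub blue.
    tileStart : ℕ → ℕ
    tileStart y = y * (y + (d + d))

    tileStart-suc : ∀ y → tileStart (suc y) ≡ tileStart y + suc ((y + d) + (y + d))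
    tileStart-suc y = eq y d
      where
      eq : ∀ y d → suc y * (suc y + (d + d)) ≡ y * (y + (d + d)) + suc ((y + d) + (y + d))
      eq = solve-∀

    tileStart-mono : ∀ {y y'} → y ≤ y' → tileStart y ≤ tileStart y'
    tileStart-mono y≤y' = *-mono-≤ y≤y' (+-monoˡ-≤ (d + d) y≤y')

    tileCentre : ℕ → ℕ
    tileCentre y = tileStart y + (y + d)

    T₀ cA cA' p : ℕ
    T₀  = tileStart (suc y₀)
    cA  = T₀ + R
    cA' = T₀ + suc (R + R) + R
    p   = T₀ + (R + R) + suc (R + R)

    open LowerBound p
    open Rim p public using (n)
    open Rim p hiding (n)
    open Burning (Wheel n)
    open OnWheel n

    n≡T₀+arcs : n ≡ T₀ + suc (R + R) + suc (R + R)
    n≡T₀+arcs = cong (_+ suc (R + R)) (sym (+-suc T₀ (R + R)))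

    at : ℕ → Fin (suc n)
    at x = suc (x mod n)

    toℕ-mod-< : ∀ {x} → x < n → toℕ (x mod n) ≡ x
    toℕ-mod-< {x} x<n = trans (toℕ-mod x) (m<n⇒m%n≡m x<n)

    tiles : ℕ → Sources
    tiles zero    = []
    tiles (suc y) = at (tileCentre y) ∷ tiles y

    sources : Sources
    sources = at cA ∷ at cA' ∷ tiles (suc y₀)

    length-sources : length sources ≡ m
    length-sources = cong (2 +_) (length-tiles (suc y₀))
      where
      length-tiles : ∀ y → length (tiles y) ≡ y
      length-tiles zero    = refl
      length-tiles (suc y) = cong suc (length-tiles y)

    cA<cA' : cA < cA'
    cA<cA' = ≤-trans (s≤s (m≤m+n cA (R + R))) (≤-reflexive (eq T₀ R))
      where
      eq : ∀ T₀ R → suc (T₀ + R + (R + R)) ≡ T₀ + suc (R + R) + R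
      eq = solve-∀

    cA'<n : cA' < n
    cA'<n = subst (cA' <_) (sym n≡T₀+arcs) (+-monoʳ-< (T₀ + suc (R + R)) (s≤s (m≤m+n R R)))

    cA<n : cA < n
    cA<n = <-trans cA<cA' cA'<n

    isSource-tiles : ∀ i y → T (isSource (Wheel n) (tiles (suc (i + y))) (suc i) (at (tileCentre y)))
    isSource-tiles zero    y = isSource-head (at (tileCentre y)) (tiles y)
    isSource-tiles (suc i) y = isSource-tiles i y

    tile-source-blue : ∀ i y → i + y ≡ y₀ → Blue sources (3 + i) (at (tileCentre y))
    tile-source-blue i y i+y≡y₀ = source⇒blue (subst SourceAt i+y≡y₀ (isSource-tiles i y))
      where
      SourceAt : ℕ → Set
      SourceAt z = T (isSource (Wheel n) (tiles (suc z)) (suc i) (at (tileCentre y)))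

    cA-blue : Blue sources 1 (at cA)
    cA-blue = source⇒blue (isSource-head (at cA) (at cA' ∷ tiles (suc y₀)))

    cA'-blue : Blue sources 2 (at cA')
    cA'-blue = source⇒blue (isSource-head (at cA') (tiles (suc y₀)))

    hub-blue : ∀ {k} → 3 ≤ k → Blue sources k zero
    hub-blue 3≤k = blue-mono 3≤k (blueNbrs⇒blue
      (wheel-hub (state (Wheel n) sources 2) cA≢cA' (isBlue (blue-suc cA-blue)) (isBlue cA'-blue)))
      where
      cA≢cA' : cA mod n ≢ cA' mod n
      cA≢cA' eq = <-irrefl (trans (sym (toℕ-mod-< cA<n)) (trans (cong toℕ eq) (toℕ-mod-< cA'<n))) cA<cA'

    blue-within : ∀ {j} c x → c < n → Blue sources j (at c) → 3 ≤ j → x + j ≡ b →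
                  ∀ v → toℕ v ≤ c + x → c ≤ toℕ v + x → Blue sources b (suc v)
    blue-within {j} c x c<n centre 3≤j x+j≡b v v≤c+x c≤v+x =
      subst₂ (λ k w → Blue sources k (suc w)) x+j≡b (fromℕ<-toℕ v (toℕ<n v))
        (rim-interval-blue (c mod n) (hub-blue 3≤j) centre x (toℕ<n v)
          (subst (λ z → toℕ v ≤ z + x) (sym c≡) v≤c+x) (subst (_≤ toℕ v + x) (sym c≡) c≤v+x))
      where
      c≡ : toℕ (c mod n) ≡ c
      c≡ = toℕ-mod-< c<n

    tile-blue : ∀ i y → i + y ≡ y₀ →
                ∀ v → tileStart y ≤ toℕ v → toℕ v < tileStart (suc y) → Blue sources b (suc v)
    tile-blue i y i+y≡y₀ v start≤v v<next =
      blue-within (tileCentre y) (y + d) centre<n (tile-source-blue i y i+y≡y₀) (m≤m+n 3 i) x+j≡b v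
        (m<n+1+2r⇒m≤n+r+r (tileStart y) (y + d) (subst (toℕ v <_) (tileStart-suc y) v<next))
        (+-monoˡ-≤ (y + d) start≤v)
      where
      y≤y₀ : y ≤ y₀
      y≤y₀ = ≤-trans (m≤n+m y i) (≤-reflexive i+y≡y₀)
      centre<n : tileCentre y < n
      centre<n = begin-strict
        tileStart y + (y + d)                 <⟨ +-monoʳ-< (tileStart y) (s≤s (m≤m+n (y + d) (y + d))) ⟩
        tileStart y + suc ((y + d) + (y + d)) ≡⟨ tileStart-suc y ⟨
        tileStart (suc y)                     ≤⟨ tileStart-mono (s≤s y≤y₀) ⟩
        T₀                                    ≤⟨ m≤m+n T₀ (R + R) ⟩
        T₀ + (R + R)                          ≤⟨ m≤m+n (T₀ + (R + R)) (suc (R + R)) ⟩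
        p                                     <⟨ n<1+n p ⟩
        n                                     ∎
        where open ≤-Reasoning
      x+j≡b : y + d + (3 + i) ≡ b
      x+j≡b = trans (eq y d i) (trans (cong (λ z → 3 + z + d) i+y≡y₀) (sym b≡m+d))
        where
        eq : ∀ y d i → y + d + (3 + i) ≡ 3 + (i + y) + d
        eq = solve-∀

    tiles-blue : ∀ y → y ≤ suc y₀ → ∀ v → toℕ v < tileStart y → Blue sources b (suc v)
    tiles-blue (suc y) y<y₀ v v<next with toℕ v <? tileStart y
    ... | yes v<start = tiles-blue y (≤-trans (n≤1+n y) y<y₀) v v<start
    ... | no  v≮start = tile-blue (y₀ ∸ y) y (m∸n+n≡m (s≤s⁻¹ y<y₀)) v (≮⇒≥ v≮start) v<next

    rim-blue : ∀ v → Blue sources b (suc v)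
    rim-blue v = by-region (toℕ v <? T₀) (toℕ v <? T₁)
      where
      T₁ : ℕ
      T₁ = T₀ + suc (R + R)
      R+3≡b : R + 3 ≡ b
      R+3≡b = trans (+-comm R 3) (sym b≡m+d)
      by-region : Dec (toℕ v < T₀) → Dec (toℕ v < T₁) → Blue sources b (suc v)
      by-region (yes v<T₀) _ = tiles-blue (suc y₀) ≤-refl v v<T₀
      by-region (no v≮T₀) (yes v<T₁) =
        blue-within cA R cA<n (blue-mono (s≤s z≤n) cA-blue) ≤-refl R+3≡b v
          (m<n+1+2r⇒m≤n+r+r T₀ R v<T₁) (+-monoˡ-≤ R (≮⇒≥ v≮T₀))
      by-region (no _) (no v≮T₁) =
        blue-within cA' R cA'<n (blue-suc cA'-blue) ≤-refl R+3≡b v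
          (m<n+1+2r⇒m≤n+r+r T₁ R (subst (toℕ v <_) n≡T₀+arcs (toℕ<n v))) (+-monoˡ-≤ R (≮⇒≥ v≮T₁))

    burnt : Burnt sources b
    burnt zero    = hub-blue (subst (3 ≤_) (sym b≡m+d) (s≤s (s≤s (s≤s z≤n))))
    burnt (suc v) = rim-blue v

    -- The ring solver does not unfold definitions, so these identities are stated with them inlined.
    n-identity₁ : n ≡ suc ((2 + R) * (2 + R)) + (e * e + 8 * e + 13)
    n-identity₁ = identity e
      where
      identity : ∀ e → let d = 3 + e ; y₀ = d * d ; R = y₀ + d in
                 suc (suc y₀ * (suc y₀ + (d + d)) + (R + R) + suc (R + R)) ≡
                 suc ((2 + R) * (2 + R)) + (e * e + 8 * e + 13)
      identity = solve-∀

    n-identity₂ : n ≡ suc ((2 + y₀) * (2 + y₀) + 2 * (2 + y₀) * suc d) + (e + e)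
    n-identity₂ = identity e
      where
      identity : ∀ e → let d = 3 + e ; y₀ = d * d ; R = y₀ + d in
                 suc (suc y₀ * (suc y₀ + (d + d)) + (R + R) + suc (R + R)) ≡
                 suc ((2 + y₀) * (2 + y₀) + 2 * (2 + y₀) * suc d) + (e + e)
      identity = solve-∀

    n≰ : ∀ {X} Y → n ≡ suc X + Y → ¬ n ≤ X
    n≰ {X} Y n≡ n≤X = <-irrefl refl (≤-<-trans n≤X (subst (X <_) (sym n≡) (s≤s (m≤m+n X Y))))

    notBefore : ∀ s k → k < b → ¬ Burnt s k
    notBefore s k k<b all = n≰ _ n-identity₁ (begin
      n                        ≤⟨ burnt⇒≤coverBound s k all ⟩
      coverBound k (length s)  ≤⟨ coverBound≤square k (length s) ⟩
      k * k                    ≤⟨ *-mono-≤ k≤2+R k≤2+R ⟩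
      (2 + R) * (2 + R)        ∎)
      where
      open ≤-Reasoning
      k≤2+R : k ≤ 2 + R
      k≤2+R = s≤s⁻¹ (subst (k <_) b≡m+d k<b)

    tooShort : ∀ s → length s < m → ¬ Burnt s b
    tooShort s short all = n≰ _ n-identity₂ (begin
      n                                          ≤⟨ burnt⇒≤coverBound s b all ⟩
      coverBound b (length s)                    ≤⟨ coverBound-monoʳ b (s≤s⁻¹ short) ⟩
      coverBound b (2 + y₀)                      ≡⟨ cong (λ k → coverBound k (2 + y₀)) b≡ ⟩
      coverBound (2 + y₀ + suc d) (2 + y₀)       ≡⟨ coverBound-+ (2 + y₀) (suc d) ⟩
      (2 + y₀) * (2 + y₀) + 2 * (2 + y₀) * suc d ∎)
      where
      open ≤-Reasoning
      b≡ : b ≡ 2 + y₀ + suc d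
      b≡ = trans b≡m+d (sym (+-suc (2 + y₀) d))

    isB2 : IsB2 (Wheel n) b
    isB2 = isB2-intro b notBefore sources burnt

    isT2 : IsT2 (Wheel n) m
    isT2 = isT2-intro b notBefore sources burnt length-sources tooShort

    n≥3 : n ≥ 3
    n≥3 = s≤s (s≤s (s≤s z≤n))

open import Defs
open import Data.Nat using (ℕ; _≥_)
open import Data.Integer using (ℤ; +_; _-_; _≤_)
open import Data.Product using (Σ; _×_)
import Data.Nat as ℕ
import Data.Nat.Properties as ℕ
open import Data.Integer using (∣_∣; -[1+_]; _⊖_; +≤+; -≤+)
open import Data.Integer.Properties using ([+m]-[+n]≡m⊖n; ⊖-≥; module ≤-Reasoning)
open import Data.Product using (_,_)
open import Relation.Binary.PropositionalEquality using (_≡_; cong; module ≡-Reasoning)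
open WheelBurning using (module Construction)

i≤+[3+∣i∣] : ∀ i → i ≤ + (3 ℕ.+ ∣ i ∣)
i≤+[3+∣i∣] (+ k)    = +≤+ (ℕ.m≤n+m k 3)
i≤+[3+∣i∣] -[1+ k ] = -≤+

+[m+n]-+m≡+n : ∀ m n → + (m ℕ.+ n) - + m ≡ + n
+[m+n]-+m≡+n m n = begin
  + (m ℕ.+ n) - + m   ≡⟨ [+m]-[+n]≡m⊖n (m ℕ.+ n) m ⟩
  m ℕ.+ n ⊖ m         ≡⟨ ⊖-≥ (ℕ.m≤m+n m n) ⟩
  + (m ℕ.+ n ℕ.∸ m)   ≡⟨ cong +_ (ℕ.m+n∸m≡n m n) ⟩
  + n                 ∎
  where open ≡-Reasoning

theorem4 : (r : ℤ) → Σ ℕ λ n → n ≥ 3 × Σ ℕ λ b → Σ ℕ λ t →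
             IsB2 (Wheel n) b × IsT2 (Wheel n) t × r ≤ (+ b) - (+ t)
theorem4 r = n , n≥3 , b , m , isB2 , isT2 , r≤b-m
  where
  open Construction ∣ r ∣
  r≤b-m : r ≤ + b - + m
  r≤b-m = begin
    r                   ≤⟨ i≤+[3+∣i∣] r ⟩
    + d                 ≡⟨ +[m+n]-+m≡+n m d ⟨
    + (m ℕ.+ d) - + m   ≡⟨ cong (λ z → + z - + m) b≡m+d ⟨
    + b - + m           ∎
    where open ≤-Reasoning
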